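{- Let $K$ be a simplicial complex on a finite vertex set $V$, let $t\ge 0$ be an integer, and let $\sigma\in K$. Then \[ \mathcal{T}_t(K)\setminus \mathcal{T}_t(\mathrm{cost}(K,\sigma)) = \left\{\sigma\cup\eta:\ \eta\in \mathcal{T}_t(\mathrm{lk}(K,\sigma))\setminus \left(\bigcup_{\substack{\sigma'\subset \sigma:\\ 1\leq |\sigma'|\leq t}} \mathcal{T}_{t-|\sigma'|}\bigl(\mathrm{lk}(K[V\setminus\sigma'],\sigma\setminus\sigma')\bigr) \right)\right\}. \]
   Context: For a simplicial complex $L$ on vertex set $V_L$, $\mathcal{T}_s(L)=\{\eta\cup\tau:\ \eta\in L,\ \tau\subset V_L,\ |\tau|\le s\}$; this depends on the vertex set, and the conventions are: $K[U]=\{\tau\in K:\tau\subset U\}$ has vertex set $U$; $\mathrm{cost}(K,\sigma)=\{\tau\in K:\sigma\not\subset\tau\}$ has vertex set $V$; $\mathrm{lk}(K,\sigma)=\{\tau\in K:\tau\cap\sigma=\varnothing,\ \tau\cup\sigma\in K\}$ has vertex set $V\setminus\sigma$ (so $\mathrm{lk}(K[V\setminus\sigma'],\sigma\setminus\sigma')$ has vertex set $V\setminus\sigma$). -}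

module Defs where

open import Data.Nat using (ℕ; _≤_)
open import Data.Fin.Subset using (Subset; _⊆_; _∪_; _∩_; ∣_∣; ⊥)
open import Data.Product using (_×_; ∃-syntax)
open import Relation.Binary.PropositionalEquality using (_≡_)
open import Relation.Nullary using (¬_)

Complex : ℕ → Set₁
Complex n = Subset n → Set

IsSimplicialComplex : ∀ {n} → Complex n → Set
IsSimplicialComplex {n} K = ∀ (τ ρ : Subset n) → ρ ⊆ τ → K τ → K ρ

induced : ∀ {n} → Complex n → Subset n → Complex n
induced K U τ = K τ × τ ⊆ U

cost : ∀ {n} → Complex n → Subset n → Complex n
cost K σ τ = K τ × ¬ (σ ⊆ τ)

lk : ∀ {n} → Complex n → Subset n → Complex n
lk K σ τ = K τ × (τ ∩ σ ≡ ⊥) × K (τ ∪ σ)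

-- T_s(L) with vertex set W made explicit:
-- {η ∪ τ : η ∈ L, τ ⊆ W, |τ| ≤ s}
T : ∀ {n} → ℕ → Subset n → Complex n → Complex n
T s W L ρ = ∃[ η ] ∃[ τ ] (L η × τ ⊆ W × ∣ τ ∣ ≤ s × ρ ≡ η ∪ τ)

-- A face ρ = α ∪ τ of T_t(K) (α ∈ K, |τ| ≤ t) lies outside T_t(cost(K,σ)) only if
-- σ ⊆ α, and then ρ ∖ σ = (α ∖ σ) ∪ (τ ∖ σ) with α ∖ σ ∈ lk(K,σ).  If σ ∪ η = γ ∪ τ
-- with γ ∈ K and σ ⊄ γ, the nonempty set σ' = σ ∖ γ must lie in τ, so
-- η = (γ ∖ σ) ∪ (τ ∖ σ) with γ ∖ σ ∈ lk(K[V ∖ σ'], σ ∖ σ') and |τ ∖ σ| ≤ t − |σ'|.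
-- Conversely, if η = β ∪ γ with β in that link, then σ ∪ η = (β ∪ (σ ∖ σ')) ∪ (σ' ∪ γ),
-- and the face β ∪ (σ ∖ σ') misses the nonempty σ' ⊆ σ, so it lies in cost(K,σ).
module Submission where

open import Defs
import Algebra.Solver.IdempotentCommutativeMonoid as ICM-Solver
import Data.Nat as ℕ
open import Data.Nat using (ℕ; _≤_; _∸_; _+_; s≤s; z≤n)
open import Data.Nat.Properties
  using (≤-trans; +-monoʳ-≤; +-suc; n≤1+n; m+[n∸m]≡n; m+n≤o⇒m≤o∸n; module ≤-Reasoning)
open import Data.Fin using (Fin; zero; suc)
open import Data.Fin.Subset
  using (Subset; _∈_; _∉_; _⊆_; _⊈_; _∪_; _∩_; _─_; ∁; ∣_∣; ⊤; ⊥; Nonempty; inside; outside)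
open import Data.Fin.Subset.Properties
  using (_∈?_; _⊆?_; nonempty?; ⊆⊤; ⊆-refl; ⊆-trans; ⊆-antisym; p⊆p∪q; x∈p∪q⁺; x∈p∪q⁻;
         x∈p∩q⁺; x∈p∩q⁻; p─q⊆p; x∈p∧x∉q⇒x∈p─q; ∣p─q∣≤∣p∣; p⊆q⇒∣p∣≤∣q∣; ∣p∩q∣≤∣p∣;
         ∉⊥; Empty-unique; x∉p⇒x∈∁p; x∈∁p⇒x∉p; ∪-comm; ∪-idempotentCommutativeMonoid)
open import Data.Vec using ([]; _∷_; here; there)
open import Data.Empty using (⊥-elim)
open import Data.Product using (_×_; ∃-syntax; _,_)
open import Data.Sum using (inj₁; inj₂; [_,_]′)
open import Function using (id)
open import Relation.Binary.PropositionalEquality using (_≡_; refl; sym; trans; cong; subst)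
open import Relation.Nullary using (¬_; yes; no; contradiction)
open import Function.Bundles using (_⇔_; mk⇔)

private
  variable
    n : ℕ
    p q r : Subset n
    x : Fin n
    s t : ℕ
    σ σ' α β γ η ρ τ U W : Subset n
    K L : Complex n

x∈p─q⇒x∉q : ∀ (p q : Subset n) → x ∈ p ─ q → x ∉ q
x∈p─q⇒x∉q (_ ∷ p) (inside  ∷ q) (there x∈p─q) (there x∈q) = x∈p─q⇒x∉q p q x∈p─q x∈q
x∈p─q⇒x∉q (_ ∷ p) (outside ∷ q) (there x∈p─q) (there x∈q) = x∈p─q⇒x∉q p q x∈p─q x∈q

p─q⊆∁q : ∀ (p q : Subset n) → p ─ q ⊆ ∁ q
p─q⊆∁q p q x∈p─q = x∉p⇒x∈∁p (x∈p─q⇒x∉q p q x∈p─q)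

p⊆∁[q─p] : ∀ (p q : Subset n) → p ⊆ ∁ (q ─ p)
p⊆∁[q─p] p q x∈p = x∉p⇒x∈∁p (λ x∈q─p → x∈p─q⇒x∉q q p x∈q─p x∈p)

q⊆p∪[q─p] : ∀ (p q : Subset n) → q ⊆ p ∪ (q ─ p)
q⊆p∪[q─p] p q {x} x∈q with x ∈? p
... | yes x∈p = x∈p∪q⁺ (inj₁ x∈p)
... | no  x∉p = x∈p∪q⁺ (inj₂ (x∈p∧x∉q⇒x∈p─q x∈q x∉p))

p⊆q⇒p∪[q─p]≡q : p ⊆ q → p ∪ (q ─ p) ≡ q
p⊆q⇒p∪[q─p]≡q {p = p} {q} p⊆q =
  ⊆-antisym (λ x∈ → [ p⊆q , p─q⊆p q p ]′ (x∈p∪q⁻ p (q ─ p) x∈)) (q⊆p∪[q─p] p q)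

p⊆∁q⇒[q∪p]─q≡p : p ⊆ ∁ q → (q ∪ p) ─ q ≡ p
p⊆∁q⇒[q∪p]─q≡p {p = p} {q} p⊆∁q = ⊆-antisym ⊆p ⊇p
  where
  ⊆p : (q ∪ p) ─ q ⊆ p
  ⊆p x∈ = [ (λ x∈q → contradiction x∈q (x∈p─q⇒x∉q (q ∪ p) q x∈)) , id ]′
            (x∈p∪q⁻ q p (p─q⊆p (q ∪ p) q x∈))
  ⊇p : p ⊆ (q ∪ p) ─ q
  ⊇p x∈p = x∈p∧x∉q⇒x∈p─q (x∈p∪q⁺ (inj₂ x∈p)) (x∈∁p⇒x∉p (p⊆∁q x∈p))

∪-distribʳ-─ : ∀ (p q r : Subset n) → (p ∪ q) ─ r ≡ (p ─ r) ∪ (q ─ r)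
∪-distribʳ-─ []      []      []            = refl
∪-distribʳ-─ (_ ∷ p) (_ ∷ q) (inside  ∷ r) = cong (_ ∷_) (∪-distribʳ-─ p q r)
∪-distribʳ-─ (_ ∷ p) (_ ∷ q) (outside ∷ r) = cong (_ ∷_) (∪-distribʳ-─ p q r)

p─[p─q]≡p∩q : ∀ (p q : Subset n) → p ─ (p ─ q) ≡ p ∩ q
p─[p─q]≡p∩q []            []            = refl
p─[p─q]≡p∩q (inside  ∷ p) (inside  ∷ q) = cong (_ ∷_) (p─[p─q]≡p∩q p q)
p─[p─q]≡p∩q (inside  ∷ p) (outside ∷ q) = cong (_ ∷_) (p─[p─q]≡p∩q p q)
p─[p─q]≡p∩q (outside ∷ p) (inside  ∷ q) = cong (_ ∷_) (p─[p─q]≡p∩q p q)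
p─[p─q]≡p∩q (outside ∷ p) (outside ∷ q) = cong (_ ∷_) (p─[p─q]≡p∩q p q)

[p─q]∪[q∩p]≡p : ∀ (p q : Subset n) → (p ─ q) ∪ (q ∩ p) ≡ p
[p─q]∪[q∩p]≡p []            []            = refl
[p─q]∪[q∩p]≡p (_       ∷ p) (inside  ∷ q) = cong (_ ∷_) ([p─q]∪[q∩p]≡p p q)
[p─q]∪[q∩p]≡p (inside  ∷ p) (outside ∷ q) = cong (_ ∷_) ([p─q]∪[q∩p]≡p p q)
[p─q]∪[q∩p]≡p (outside ∷ p) (outside ∷ q) = cong (_ ∷_) ([p─q]∪[q∩p]≡p p q)

p∩q≡⊥⁺ : (∀ {x} → x ∈ p → x ∉ q) → p ∩ q ≡ ⊥
p∩q≡⊥⁺ {p = p} {q} disjoint =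
  Empty-unique λ (_ , x∈p∩q) → let (x∈p , x∈q) = x∈p∩q⁻ p q x∈p∩q in disjoint x∈p x∈q

p∩q≡⊥⁻ : p ∩ q ≡ ⊥ → x ∈ p → x ∉ q
p∩q≡⊥⁻ p∩q≡⊥ x∈p x∈q = ∉⊥ (subst (_ ∈_) p∩q≡⊥ (x∈p∩q⁺ (x∈p , x∈q)))

r⊆q⇒[p─q]∩r≡⊥ : r ⊆ q → (p ─ q) ∩ r ≡ ⊥
r⊆q⇒[p─q]∩r≡⊥ {q = q} {p = p} r⊆q = p∩q≡⊥⁺ λ x∈p─q x∈r → x∈p─q⇒x∉q p q x∈p─q (r⊆q x∈r)

Nonempty⇒1≤∣p∣ : Nonempty p → 1 ≤ ∣ p ∣
Nonempty⇒1≤∣p∣ {p = inside  ∷ _} _                 = s≤s z≤n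
Nonempty⇒1≤∣p∣ {p = outside ∷ _} (suc x , there x∈p) = Nonempty⇒1≤∣p∣ (x , x∈p)

1≤∣p∣⇒Nonempty : 1 ≤ ∣ p ∣ → Nonempty p
1≤∣p∣⇒Nonempty {p = inside  ∷ _} _   = zero , here
1≤∣p∣⇒Nonempty {p = outside ∷ _} 1≤∣p∣ with 1≤∣p∣⇒Nonempty 1≤∣p∣
... | x , x∈p = suc x , there x∈p

p⊈q⇒Nonempty[p─q] : p ⊈ q → Nonempty (p ─ q)
p⊈q⇒Nonempty[p─q] {p = p} {q} p⊈q with nonempty? (p ─ q)
... | yes p─q-nonempty = p─q-nonempty
... | no  p─q-empty    = ⊥-elim (p⊈q p⊆q)
  where
  p⊆q : p ⊆ q
  p⊆q x∈p = [ id , (λ x∈p─q → contradiction (_ , x∈p─q) p─q-empty) ]′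
              (x∈p∪q⁻ q (p ─ q) (q⊆p∪[q─p] q p x∈p))

∣p∪q∣≤∣p∣+∣q∣ : ∀ (p q : Subset n) → ∣ p ∪ q ∣ ≤ ∣ p ∣ + ∣ q ∣
∣p∪q∣≤∣p∣+∣q∣ []            []            = z≤n
∣p∪q∣≤∣p∣+∣q∣ (inside  ∷ p) (inside  ∷ q) =
  s≤s (≤-trans (∣p∪q∣≤∣p∣+∣q∣ p q) (+-monoʳ-≤ ∣ p ∣ (n≤1+n ∣ q ∣)))
∣p∪q∣≤∣p∣+∣q∣ (inside  ∷ p) (outside ∷ q) = s≤s (∣p∪q∣≤∣p∣+∣q∣ p q)
∣p∪q∣≤∣p∣+∣q∣ (outside ∷ p) (inside  ∷ q) rewrite +-suc ∣ p ∣ ∣ q ∣ = s≤s (∣p∪q∣≤∣p∣+∣q∣ p q)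
∣p∪q∣≤∣p∣+∣q∣ (outside ∷ p) (outside ∷ q) = ∣p∪q∣≤∣p∣+∣q∣ p q

∣p─q∣+∣p∩q∣≡∣p∣ : ∀ (p q : Subset n) → ∣ p ─ q ∣ + ∣ p ∩ q ∣ ≡ ∣ p ∣
∣p─q∣+∣p∩q∣≡∣p∣ []            []            = refl
∣p─q∣+∣p∩q∣≡∣p∣ (inside  ∷ p) (inside  ∷ q) =
  trans (+-suc ∣ p ─ q ∣ ∣ p ∩ q ∣) (cong ℕ.suc (∣p─q∣+∣p∩q∣≡∣p∣ p q))
∣p─q∣+∣p∩q∣≡∣p∣ (inside  ∷ p) (outside ∷ q) = cong ℕ.suc (∣p─q∣+∣p∩q∣≡∣p∣ p q)
∣p─q∣+∣p∩q∣≡∣p∣ (outside ∷ p) (inside  ∷ q) = ∣p─q∣+∣p∩q∣≡∣p∣ p q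
∣p─q∣+∣p∩q∣≡∣p∣ (outside ∷ p) (outside ∷ q) = ∣p─q∣+∣p∩q∣≡∣p∣ p q

⋃T-lk-induced : ℕ → Subset n → Complex n → Complex n
⋃T-lk-induced t σ K η =
  ∃[ σ' ] (σ' ⊆ σ × 1 ≤ ∣ σ' ∣ × ∣ σ' ∣ ≤ t × T (t ∸ ∣ σ' ∣) (∁ σ) (lk (induced K (∁ σ')) (σ ─ σ')) η)

lk⊆∁ : lk K σ α → α ⊆ ∁ σ
lk⊆∁ (_ , α∩σ≡⊥ , _) x∈α = x∉p⇒x∈∁p (p∩q≡⊥⁻ α∩σ≡⊥ x∈α)

T-⊆ : (∀ {η} → L η → η ⊆ U) → W ⊆ U → T s W L ρ → ρ ⊆ U
T-⊆ L⊆U W⊆U (η , τ , Lη , τ⊆W , _ , refl) x∈η∪τ =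
  [ L⊆U Lη , (λ x∈τ → W⊆U (τ⊆W x∈τ)) ]′ (x∈p∪q⁻ η τ x∈η∪τ)

[α∪τ]─σ∈T : L (α ─ σ) → ∣ τ ─ σ ∣ ≤ s → T s (∁ σ) L ((α ∪ τ) ─ σ)
[α∪τ]─σ∈T {α = α} {σ = σ} {τ = τ} Lα─σ ∣τ─σ∣≤s =
  α ─ σ , τ ─ σ , Lα─σ , p─q⊆∁q τ σ , ∣τ─σ∣≤s , ∪-distribʳ-─ α τ σ

α─σ∈lk : IsSimplicialComplex K → K α → σ ⊆ α → lk K σ (α ─ σ)
α─σ∈lk {K = K} {α = α} {σ = σ} closed Kα σ⊆α =
  closed α (α ─ σ) (p─q⊆p α σ) Kα , r⊆q⇒[p─q]∩r≡⊥ ⊆-refl , subst K (sym α─σ∪σ≡α) Kα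
  where
  α─σ∪σ≡α : (α ─ σ) ∪ σ ≡ α
  α─σ∪σ≡α = trans (∪-comm (α ─ σ) σ) (p⊆q⇒p∪[q─p]≡q σ⊆α)

γ─σ∈lk-induced : IsSimplicialComplex K → K γ → lk (induced K (∁ (σ ─ γ))) (σ ─ (σ ─ γ)) (γ ─ σ)
γ─σ∈lk-induced {K = K} {γ = γ} {σ = σ} closed Kγ =
    (closed γ (γ ─ σ) (p─q⊆p γ σ) Kγ , ⊆-trans (p─q⊆p γ σ) γ⊆∁[σ─γ])
  , r⊆q⇒[p─q]∩r≡⊥ (p─q⊆p σ (σ ─ γ))
  , (subst K (sym split) Kγ , subst (_⊆ ∁ (σ ─ γ)) (sym split) γ⊆∁[σ─γ])
  where
  γ⊆∁[σ─γ] : γ ⊆ ∁ (σ ─ γ)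
  γ⊆∁[σ─γ] = p⊆∁[q─p] γ σ
  split : (γ ─ σ) ∪ (σ ─ (σ ─ γ)) ≡ γ
  split = trans (cong ((γ ─ σ) ∪_) (p─[p─q]≡p∩q σ γ)) ([p─q]∪[q∩p]≡p γ σ)

β∪[σ─σ']∈cost : σ' ⊆ σ → Nonempty σ' → lk (induced K (∁ σ')) (σ ─ σ') β → cost K σ (β ∪ (σ ─ σ'))
β∪[σ─σ']∈cost {σ' = σ'} {σ = σ} {β = β} σ'⊆σ (_ , x∈σ') ((_ , β⊆∁σ') , _ , Kβ∪[σ─σ'] , _) =
  Kβ∪[σ─σ'] , λ σ⊆β∪[σ─σ'] →
    [ (λ x∈β → x∈∁p⇒x∉p (β⊆∁σ' x∈β) x∈σ') , (λ x∈σ─σ' → x∈p─q⇒x∉q σ σ' x∈σ─σ' x∈σ') ]′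
      (x∈p∪q⁻ β (σ ─ σ') (σ⊆β∪[σ─σ'] (σ'⊆σ x∈σ')))

σ∪T-lk⊆T : T t (∁ σ) (lk K σ) η → T t ⊤ K (σ ∪ η)
σ∪T-lk⊆T {σ = σ} (α , β , (_ , _ , Kα∪σ) , _ , ∣β∣≤t , refl) =
  α ∪ σ , β , Kα∪σ , ⊆⊤ , ∣β∣≤t ,
  solve 3 (λ σ α β → σ ⊕ (α ⊕ β) ⊜ (α ⊕ σ) ⊕ β) refl σ α β
  where open ICM-Solver (∪-idempotentCommutativeMonoid _)

σ∪⋃T-lk-induced⊆T-cost : ⋃T-lk-induced t σ K η → T t ⊤ (cost K σ) (σ ∪ η)
σ∪⋃T-lk-induced⊆T-cost {t = t} {σ = σ} {K = K}
  (σ' , σ'⊆σ , 1≤∣σ'∣ , ∣σ'∣≤t , β , γ , lkβ , _ , ∣γ∣≤t∸∣σ'∣ , refl) =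
  β ∪ (σ ─ σ') , σ' ∪ γ , β∪[σ─σ']∈cost {K = K} σ'⊆σ (1≤∣p∣⇒Nonempty 1≤∣σ'∣) lkβ , ⊆⊤ ,
  ∣σ'∪γ∣≤t , rearrange
  where
  ∣σ'∪γ∣≤t : ∣ σ' ∪ γ ∣ ≤ t
  ∣σ'∪γ∣≤t = begin
    ∣ σ' ∪ γ ∣              ≤⟨ ∣p∪q∣≤∣p∣+∣q∣ σ' γ ⟩
    ∣ σ' ∣ + ∣ γ ∣          ≤⟨ +-monoʳ-≤ ∣ σ' ∣ ∣γ∣≤t∸∣σ'∣ ⟩
    ∣ σ' ∣ + (t ∸ ∣ σ' ∣)   ≡⟨ m+[n∸m]≡n ∣σ'∣≤t ⟩
    t                       ∎
    where open ≤-Reasoning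
  rearrange : σ ∪ (β ∪ γ) ≡ (β ∪ (σ ─ σ')) ∪ (σ' ∪ γ)
  rearrange = trans (cong (_∪ (β ∪ γ)) (sym (p⊆q⇒p∪[q─p]≡q σ'⊆σ)))
    (solve 4 (λ σ' σ─σ' β γ → (σ' ⊕ σ─σ') ⊕ (β ⊕ γ) ⊜ (β ⊕ σ─σ') ⊕ (σ' ⊕ γ)) refl σ' (σ ─ σ') β γ)
    where open ICM-Solver (∪-idempotentCommutativeMonoid _)

σ∪η∈T-cost⇒η∈⋃T-lk-induced :
  IsSimplicialComplex K → η ⊆ ∁ σ → T t ⊤ (cost K σ) (σ ∪ η) → ⋃T-lk-induced t σ K η
σ∪η∈T-cost⇒η∈⋃T-lk-induced {η = η} {σ = σ} {t = t} closed η⊆∁σ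
  (γ , τ , (Kγ , σ⊈γ) , _ , ∣τ∣≤t , σ∪η≡γ∪τ) =
  σ ─ γ , p─q⊆p σ γ , Nonempty⇒1≤∣p∣ (p⊈q⇒Nonempty[p─q] σ⊈γ) , ∣σ─γ∣≤t ,
  subst (T (t ∸ ∣ σ ─ γ ∣) (∁ σ) _) [γ∪τ]─σ≡η ([α∪τ]─σ∈T (γ─σ∈lk-induced closed Kγ) ∣τ─σ∣≤t∸∣σ─γ∣)
  where
  σ─γ⊆τ∩σ : σ ─ γ ⊆ τ ∩ σ
  σ─γ⊆τ∩σ {x} x∈σ─γ = x∈p∩q⁺ (x∈τ , x∈σ)
    where
    x∈σ : x ∈ σ
    x∈σ = p─q⊆p σ γ x∈σ─γ
    x∈τ : x ∈ τ
    x∈τ = [ (λ x∈γ → contradiction x∈γ (x∈p─q⇒x∉q σ γ x∈σ─γ)) , id ]′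
            (x∈p∪q⁻ γ τ (subst (_ ∈_) σ∪η≡γ∪τ (p⊆p∪q η x∈σ)))
  ∣σ─γ∣≤t : ∣ σ ─ γ ∣ ≤ t
  ∣σ─γ∣≤t = ≤-trans (p⊆q⇒∣p∣≤∣q∣ σ─γ⊆τ∩σ) (≤-trans (∣p∩q∣≤∣p∣ τ σ) ∣τ∣≤t)
  ∣τ─σ∣≤t∸∣σ─γ∣ : ∣ τ ─ σ ∣ ≤ t ∸ ∣ σ ─ γ ∣
  ∣τ─σ∣≤t∸∣σ─γ∣ = m+n≤o⇒m≤o∸n ∣ τ ─ σ ∣ (begin
    ∣ τ ─ σ ∣ + ∣ σ ─ γ ∣   ≤⟨ +-monoʳ-≤ ∣ τ ─ σ ∣ (p⊆q⇒∣p∣≤∣q∣ σ─γ⊆τ∩σ) ⟩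
    ∣ τ ─ σ ∣ + ∣ τ ∩ σ ∣   ≡⟨ ∣p─q∣+∣p∩q∣≡∣p∣ τ σ ⟩
    ∣ τ ∣                   ≤⟨ ∣τ∣≤t ⟩
    t                       ∎)
    where open ≤-Reasoning
  [γ∪τ]─σ≡η : (γ ∪ τ) ─ σ ≡ η
  [γ∪τ]─σ≡η = trans (cong (_─ σ) (sym σ∪η≡γ∪τ)) (p⊆∁q⇒[q∪p]─q≡p η⊆∁σ)

ρ∈T∖T-cost⇒σ⊆ρ×ρ─σ∈T-lk :
  IsSimplicialComplex K → T t ⊤ K ρ → ¬ T t ⊤ (cost K σ) ρ → σ ⊆ ρ × T t (∁ σ) (lk K σ) (ρ ─ σ)
ρ∈T∖T-cost⇒σ⊆ρ×ρ─σ∈T-lk {σ = σ} closed (α , τ , Kα , _ , ∣τ∣≤t , refl) ρ∉T-cost with σ ⊆? α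
... | no  σ⊈α = ⊥-elim (ρ∉T-cost (α , τ , (Kα , σ⊈α) , ⊆⊤ , ∣τ∣≤t , refl))
... | yes σ⊆α =
  ⊆-trans σ⊆α (p⊆p∪q τ) , [α∪τ]─σ∈T (α─σ∈lk closed Kα σ⊆α) (≤-trans (∣p─q∣≤∣p∣ τ σ) ∣τ∣≤t)

lemma4p1 : ∀ {n} (K : Complex n) → IsSimplicialComplex K →
    (t : ℕ) (σ : Subset n) → K σ → ∀ (ρ : Subset n) →
    (T t ⊤ K ρ × ¬ T t ⊤ (cost K σ) ρ)
      ⇔ (∃[ η ] ((T t (∁ σ) (lk K σ) η
                  × ¬ (∃[ σ' ] (σ' ⊆ σ × 1 ≤ ∣ σ' ∣ × ∣ σ' ∣ ≤ t
                        × T (t ∸ ∣ σ' ∣) (∁ σ) (lk (induced K (∁ σ')) (σ ─ σ')) η)))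
                 × ρ ≡ σ ∪ η))
lemma4p1 K closed t σ _ ρ = mk⇔ to from
  where
  to : T t ⊤ K ρ × ¬ T t ⊤ (cost K σ) ρ →
       ∃[ η ] ((T t (∁ σ) (lk K σ) η × ¬ ⋃T-lk-induced t σ K η) × ρ ≡ σ ∪ η)
  to (ρ∈T , ρ∉T-cost) with ρ∈T∖T-cost⇒σ⊆ρ×ρ─σ∈T-lk closed ρ∈T ρ∉T-cost
  ... | σ⊆ρ , ρ─σ∈T-lk = ρ ─ σ , (ρ─σ∈T-lk , ρ─σ∉⋃) , sym σ∪[ρ─σ]≡ρ
    where
    σ∪[ρ─σ]≡ρ : σ ∪ (ρ ─ σ) ≡ ρ
    σ∪[ρ─σ]≡ρ = p⊆q⇒p∪[q─p]≡q σ⊆ρ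
    ρ─σ∉⋃ : ¬ ⋃T-lk-induced t σ K (ρ ─ σ)
    ρ─σ∉⋃ ρ─σ∈⋃ = ρ∉T-cost (subst (T t ⊤ (cost K σ)) σ∪[ρ─σ]≡ρ (σ∪⋃T-lk-induced⊆T-cost ρ─σ∈⋃))
  from : ∃[ η ] ((T t (∁ σ) (lk K σ) η × ¬ ⋃T-lk-induced t σ K η) × ρ ≡ σ ∪ η) →
         T t ⊤ K ρ × ¬ T t ⊤ (cost K σ) ρ
  from (η , (η∈T-lk , η∉⋃) , refl) =
    σ∪T-lk⊆T η∈T-lk , λ ρ∈T-cost → η∉⋃ (σ∪η∈T-cost⇒η∈⋃T-lk-induced closed η⊆∁σ ρ∈T-cost)
    where
    η⊆∁σ : η ⊆ ∁ σ
    η⊆∁σ = T-⊆ (lk⊆∁ {K = K}) ⊆-refl η∈T-lk
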